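{- Let $\Gamma$ be a tetravalent graph of girth $5$ admitting a half-arc-transitive subgroup $G\le\mathrm{Aut}(\Gamma)$ and let $\vec\Gamma$ be one of the two $G$-induced orientations of $\Gamma$. Then the natural action of $G$ on the set of all $2$-arcs of $\vec\Gamma$ is transitive if and only if $|G_v|>2$ for each vertex $v$ of $\Gamma$. Moreover, if $|G_v|=2$ for each vertex $v$, then $G$ has exactly two orbits on the set of $2$-arcs of $\vec\Gamma$, for each vertex $v$ there are exactly two $2$-arcs with middle vertex $v$ from each of these two orbits, and the two $2$-arcs with middle vertex $v$ from the same orbit have no edge in common.
   Context: Graphs are finite, simple, connected. $G\le\mathrm{Aut}(\Gamma)$ is half-arc-transitive if transitive on vertices and edges but not on arcs (ordered pairs of adjacent vertices). Then $G$ has two orbits on arcs, each containing exactly one of $(u,v),(v,u)$ per edge; each orbit is a $G$-induced orientation $\vec\Gamma$. A $2$-arc of $\vec\Gamma$ is a directed path $(u,v,w)$ with $u\to v\to w$; $v$ is its middle vertex. $G_v$ is the stabilizer of $v$ in $G$. -}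

module Defs where

open import Data.Nat using (ℕ; _<_)
open import Data.Bool using (Bool; true; false)
open import Data.Empty using (⊥)
open import Data.Fin using (Fin; _≟_)
open import Data.List using (List; length; filter; filterᵇ; allFin)
open import Data.List.Membership.Propositional using (_∈_)
open import Data.List.Relation.Unary.AllPairs using (AllPairs)
open import Data.Product using (Σ; ∃; ∃-syntax; _×_; _,_)
open import Data.Sum using (_⊎_)
open import Relation.Nullary using (¬_)
open import Relation.Binary.PropositionalEquality using (_≡_; _≢_)
open import Function.Definitions using (Injective)

record Graph (n : ℕ) : Set where
  field
    adj        : Fin n → Fin n → Bool
    adj-sym    : ∀ u v → adj u v ≡ adj v u
    adj-irrefl : ∀ v → adj v v ≡ false

Map : ℕ → Set
Map n = Fin n → Fin n

_≐_ : ∀ {n} → Map n → Map n → Set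
f ≐ g = ∀ x → f x ≡ g x

module _ {n : ℕ} (Γ : Graph n) where
  open Graph Γ

  Adj : Fin n → Fin n → Set
  Adj u v = adj u v ≡ true

  data Reach : Fin n → Fin n → Set where
    here : ∀ {u} → Reach u u
    step : ∀ {u v w} → Adj u v → Reach v w → Reach u w

  Connected : Set
  Connected = ∀ u v → Reach u v

  degree : Fin n → ℕ
  degree v = length (filterᵇ (adj v) (allFin n))

  Tetravalent : Set
  Tetravalent = ∀ v → degree v ≡ 4

  -- cycles of length 3, 4, 5 (vertices pairwise distinct; consecutive
  -- vertices are automatically distinct since adjacency is irreflexive)
  Cycle3 : Set
  Cycle3 = ∃[ a ] ∃[ b ] ∃[ c ] (Adj a b × Adj b c × Adj c a)

  Cycle4 : Set
  Cycle4 = ∃[ a ] ∃[ b ] ∃[ c ] ∃[ d ]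
             (Adj a b × Adj b c × Adj c d × Adj d a × a ≢ c × b ≢ d)

  Cycle5 : Set
  Cycle5 = ∃[ a ] ∃[ b ] ∃[ c ] ∃[ d ] ∃[ e ]
             ((Adj a b × Adj b c × Adj c d × Adj d e × Adj e a) ×
              (a ≢ b × a ≢ c × a ≢ d × a ≢ e × b ≢ c × b ≢ d × b ≢ e ×
               c ≢ d × c ≢ e × d ≢ e))

  Girth5 : Set
  Girth5 = ¬ Cycle3 × ¬ Cycle4 × Cycle5

  -- automorphism: a bijection (injective self-map of a finite set)
  -- preserving adjacency and non-adjacency
  IsAut : Map n → Set
  IsAut g = Injective _≡_ _≡_ g × (∀ u v → adj (g u) (g v) ≡ adj u v)

  record AutSubgroup : Set where
    field
      elems    : List (Map n)
      all-aut  : ∀ g → g ∈ elems → IsAut g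
      distinct : AllPairs (λ f g → ¬ (f ≐ g)) elems
      has-id   : ∃[ e ] (e ∈ elems × (∀ x → e x ≡ x))
      closed-∘ : ∀ g h → g ∈ elems → h ∈ elems →
                   ∃[ k ] (k ∈ elems × (∀ x → k x ≡ g (h x)))
      closed-⁻¹ : ∀ g → g ∈ elems →
                   ∃[ k ] (k ∈ elems × (∀ x → k (g x) ≡ x))

  module _ (G : AutSubgroup) where
    open AutSubgroup G

    VertexTransitive : Set
    VertexTransitive = ∀ u v → ∃[ g ] (g ∈ elems × g u ≡ v)

    EdgeTransitive : Set
    EdgeTransitive = ∀ u v x y → Adj u v → Adj x y →
      ∃[ g ] (g ∈ elems × ((g u ≡ x × g v ≡ y) ⊎ (g u ≡ y × g v ≡ x)))

    ArcTransitive : Set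
    ArcTransitive = ∀ u v x y → Adj u v → Adj x y →
      ∃[ g ] (g ∈ elems × g u ≡ x × g v ≡ y)

    HalfArcTransitive : Set
    HalfArcTransitive = VertexTransitive × EdgeTransitive × ¬ ArcTransitive

    stabSize : Fin n → ℕ
    stabSize v = length (filter (λ g → g v ≟ v) elems)

    -- the G-induced orientation containing the arc (a,b):
    -- u → v iff (u,v) lies in the G-orbit of (a,b)
    module Orientation (a b : Fin n) where
      _⟶_ : Fin n → Fin n → Set
      u ⟶ v = ∃[ g ] (g ∈ elems × g a ≡ u × g b ≡ v)

      TwoArc : Fin n → Fin n → Fin n → Set
      TwoArc u v w = u ⟶ v × v ⟶ w

      SameOrbit : (Fin n × Fin n × Fin n) → (Fin n × Fin n × Fin n) → Set
      SameOrbit (u , v , w) (u' , v' , w') =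
        ∃[ g ] (g ∈ elems × g u ≡ u' × g v ≡ v' × g w ≡ w')

      TransitiveOn2Arcs : Set
      TransitiveOn2Arcs = ∀ u v w u' v' w' →
        TwoArc u v w → TwoArc u' v' w' → SameOrbit (u , v , w) (u' , v' , w')

      SameEdge : Fin n → Fin n → Fin n → Fin n → Set
      SameEdge x y x' y' = (x ≡ x' × y ≡ y') ⊎ (x ≡ y' × y ≡ x')

      NoCommonEdge : Fin n → Fin n → Fin n → Fin n → Fin n → Set
      NoCommonEdge u v w u' w' =
        ¬ SameEdge u v u' v × ¬ SameEdge u v v w' ×
        ¬ SameEdge v w u' v × ¬ SameEdge v w v w'

      ExactlyTwoOrbits : Set
      ExactlyTwoOrbits =
        ∃[ u₁ ] ∃[ v₁ ] ∃[ w₁ ] ∃[ u₂ ] ∃[ v₂ ] ∃[ w₂ ]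
          (TwoArc u₁ v₁ w₁ × TwoArc u₂ v₂ w₂ ×
           ¬ SameOrbit (u₁ , v₁ , w₁) (u₂ , v₂ , w₂) ×
           (∀ u v w → TwoArc u v w →
              SameOrbit (u₁ , v₁ , w₁) (u , v , w) ⊎
              SameOrbit (u₂ , v₂ , w₂) (u , v , w)))

      TwoPerOrbitAtEachVertex : Set
      TwoPerOrbitAtEachVertex = ∀ x y z → TwoArc x y z → ∀ v →
        ∃[ u ] ∃[ w ] ∃[ u' ] ∃[ w' ]
          (TwoArc u v w × SameOrbit (x , y , z) (u , v , w) ×
           TwoArc u' v w' × SameOrbit (x , y , z) (u' , v , w') ×
           ¬ (u ≡ u' × w ≡ w') ×
           (∀ s t → TwoArc s v t → SameOrbit (x , y , z) (s , v , t) →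
              (s ≡ u × t ≡ w) ⊎ (s ≡ u' × t ≡ w')) ×
           NoCommonEdge u v w u' w')

{-# OPTIONS --safe #-}
module Submission where

-- In the orientation every vertex v has two in-neighbours u₁, u₂ and two
-- out-neighbours w₁, w₂: the in- and out-degrees add up to 4 and are both
-- positive, and a unique out-neighbour at every vertex would be a map
-- Fin n → Fin n with two sections of disjoint images. Some element of G_v
-- maps u₁ to u₂, and everything depends on whether some element of G_v
-- fixes u₁ and maps w₁ to w₂.
--   If so, G_v moves every 2-arc with middle vertex v to (u₁, v, w₁), so G is
-- transitive on 2-arcs, and the identity, that element and one mapping u₁
-- to u₂ are three elements of G_v.
--   If not, an element of G_v fixes an in-neighbour of v iff it fixes an
-- out-neighbour; by connectivity an element fixing an edge fixes every
-- vertex, so an element of G_v is determined by its action on u₁ and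
-- |G_v| ≤ 2. Then (u₁, v, w₁) and (u₁, v, w₂) lie in different orbits, and
-- the non-trivial element of G_v pairs off the two 2-arcs at v of each orbit.

open import Defs
open import Data.Nat using (ℕ; suc; _+_; _≤_; _<_; z≤n; s≤s)
open import Data.Nat.Properties using (+-suc; m<m+n; <⇒≱; <-irrefl; m<n⇒m<1+n)
open import Data.Fin using (Fin; _≟_; splitAt; join)
open import Data.Fin.Properties using (injective⇒≤; join-splitAt)
open import Data.Product using (_×_; _,_; proj₁; proj₂; ∃-syntax)
open import Data.Sum using (_⊎_; inj₁; inj₂; [_,_])
open import Data.Empty using (⊥; ⊥-elim)
open import Data.Bool using (T?)
open import Data.Bool.Properties using (T-≡)
open import Data.List using (List; []; _∷_; length; filter; filterᵇ; allFin)
open import Data.List.Membership.Propositional using (_∈_; find; lose)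
open import Data.List.Membership.Propositional.Properties
  using (∈-filter⁺; ∈-filter⁻; ∈-allFin; ∈-length)
open import Data.List.Relation.Unary.Any using (here; there; any?)
open import Data.List.Relation.Unary.All using ([]; _∷_)
open import Data.List.Relation.Unary.AllPairs using (AllPairs; []; _∷_)
import Data.List.Relation.Unary.AllPairs.Properties as AllPairs
open import Data.List.Relation.Unary.Unique.Propositional using (Unique)
open import Data.List.Relation.Unary.Unique.Propositional.Properties using (allFin⁺; filter⁺)
open import Function using (_∘_)
open import Function.Bundles using (_⇔_; mk⇔; Equivalence)
open import Function.Definitions using (Injective)
open import Level using (0ℓ)
open import Relation.Nullary using (¬_; Dec; yes; no)
open import Relation.Nullary.Decidable using (_×-dec_)
open import Relation.Binary.PropositionalEquality
  using (_≡_; _≢_; refl; sym; trans; cong; subst)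
open import Relation.Unary using (Pred; Decidable)
open import Relation.Unary.Properties using (∁?)

open Equivalence using (to; from)

module _ {A : Set} where

  length-filter+length-filter∁ : {P : Pred A 0ℓ} (P? : Decidable P) (xs : List A) →
    length (filter P? xs) + length (filter (∁? P?) xs) ≡ length xs
  length-filter+length-filter∁ P? [] = refl
  length-filter+length-filter∁ P? (x ∷ xs) with P? x
  ... | yes _ = cong suc (length-filter+length-filter∁ P? xs)
  ... | no _ = trans (+-suc _ _) (cong suc (length-filter+length-filter∁ P? xs))

  length≡1⇒∈-equal : ∀ {xs} {x y : A} → length xs ≡ 1 → x ∈ xs → y ∈ xs → x ≡ y
  length≡1⇒∈-equal {_ ∷ []} _ (here refl) (here refl) = refl

  length≤1 : ∀ {xs : List A} → Unique xs → (∀ {x y} → x ∈ xs → y ∈ xs → x ≡ y) →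
    length xs ≤ 1
  length≤1 {[]} _ _ = z≤n
  length≤1 {_ ∷ []} _ _ = s≤s z≤n
  length≤1 {_ ∷ _ ∷ _} ((x≢y ∷ _) ∷ _) ∈-equal =
    ⊥-elim (x≢y (∈-equal (here refl) (there (here refl))))

  length≡2⇒pair : ∀ {xs : List A} → Unique xs → length xs ≡ 2 →
    ∃[ x ] ∃[ y ] (x ∈ xs × y ∈ xs × x ≢ y × (∀ {z} → z ∈ xs → z ≡ x ⊎ z ≡ y))
  length≡2⇒pair {x ∷ y ∷ []} ((x≢y ∷ []) ∷ _) refl =
    x , y , here refl , there (here refl) , x≢y , λ where
      (here z≡x) → inj₁ z≡x
      (there (here z≡y)) → inj₂ z≡y

  1<length : ∀ {x y : A} {xs} → x ∈ xs → y ∈ xs → x ≢ y → 1 < length xs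
  1<length (here refl) (here refl) x≢y = ⊥-elim (x≢y refl)
  1<length (here refl) (there y∈) _ = s≤s (∈-length y∈)
  1<length (there x∈) (here refl) _ = s≤s (∈-length x∈)
  1<length (there x∈) (there y∈) x≢y = m<n⇒m<1+n (1<length x∈ y∈ x≢y)

  2<length : ∀ {x y z : A} {xs} → x ∈ xs → y ∈ xs → z ∈ xs →
    x ≢ y → x ≢ z → y ≢ z → 2 < length xs
  2<length (here refl) (here refl) _ x≢y _ _ = ⊥-elim (x≢y refl)
  2<length (here refl) (there _) (here refl) _ x≢z _ = ⊥-elim (x≢z refl)
  2<length (here refl) (there y∈) (there z∈) _ _ y≢z = s≤s (1<length y∈ z∈ y≢z)
  2<length (there _) (here refl) (here refl) _ _ y≢z = ⊥-elim (y≢z refl)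
  2<length (there x∈) (here refl) (there z∈) _ x≢z _ = s≤s (1<length x∈ z∈ x≢z)
  2<length (there x∈) (there y∈) (here refl) x≢y _ _ = s≤s (1<length x∈ y∈ x≢y)
  2<length (there x∈) (there y∈) (there z∈) x≢y x≢z y≢z =
    m<n⇒m<1+n (2<length x∈ y∈ z∈ x≢y x≢z y≢z)

  AllPairs⇒length≤2 : {R : A → A → Set} {xs : List A} → AllPairs R xs →
    (∀ {x y z} → x ∈ xs → y ∈ xs → z ∈ xs → R x y → R x z → R y z → ⊥) →
    length xs ≤ 2
  AllPairs⇒length≤2 {xs = []} _ _ = z≤n
  AllPairs⇒length≤2 {xs = _ ∷ []} _ _ = s≤s z≤n
  AllPairs⇒length≤2 {xs = _ ∷ _ ∷ []} _ _ = s≤s (s≤s z≤n)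
  AllPairs⇒length≤2 {xs = _ ∷ _ ∷ _ ∷ _} ((Rxy ∷ Rxz ∷ _) ∷ (Ryz ∷ _) ∷ _) no-triangle =
    ⊥-elim (no-triangle (here refl) (there (here refl)) (there (there (here refl))) Rxy Rxz Ryz)

module _ {A : Set} {p q : A} where

  fixes-or-swaps : {f : A → A} → Injective _≡_ _≡_ f → p ≢ q →
    f p ≡ p ⊎ f p ≡ q → f q ≡ p ⊎ f q ≡ q →
    (f p ≡ p × f q ≡ q) ⊎ (f p ≡ q × f q ≡ p)
  fixes-or-swaps f-inj p≢q (inj₁ fp) (inj₁ fq) = ⊥-elim (p≢q (f-inj (trans fp (sym fq))))
  fixes-or-swaps f-inj p≢q (inj₁ fp) (inj₂ fq) = inj₁ (fp , fq)
  fixes-or-swaps f-inj p≢q (inj₂ fp) (inj₁ fq) = inj₂ (fp , fq)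
  fixes-or-swaps f-inj p≢q (inj₂ fp) (inj₂ fq) = ⊥-elim (p≢q (f-inj (trans fp (sym fq))))

  fixes-pair⇒fixes : ∀ {f : A → A} {x} → x ≡ p ⊎ x ≡ q → f p ≡ p → f q ≡ q → f x ≡ x
  fixes-pair⇒fixes (inj₁ refl) fp _ = fp
  fixes-pair⇒fixes (inj₂ refl) _ fq = fq

  swaps-pair⇒moves : ∀ {f : A → A} {x} → p ≢ q → x ≡ p ⊎ x ≡ q →
    f p ≡ q → f q ≡ p → f x ≢ x
  swaps-pair⇒moves p≢q (inj₁ refl) fp _ fx = p≢q (trans (sym fx) fp)
  swaps-pair⇒moves p≢q (inj₂ refl) _ fq fx = p≢q (trans (sym fq) fx)

  permutes-pair⇒onto : ∀ {f : A → A} {z} →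
    (f p ≡ p × f q ≡ q) ⊎ (f p ≡ q × f q ≡ p) → z ≡ p ⊎ z ≡ q → f p ≡ z ⊎ f q ≡ z
  permutes-pair⇒onto (inj₁ (fp , _)) (inj₁ refl) = inj₁ fp
  permutes-pair⇒onto (inj₁ (_ , fq)) (inj₂ refl) = inj₂ fq
  permutes-pair⇒onto (inj₂ (_ , fq)) (inj₁ refl) = inj₂ fq
  permutes-pair⇒onto (inj₂ (fp , _)) (inj₂ refl) = inj₁ fp

  pair-pigeonhole : ∀ {x y z} → x ≡ p ⊎ x ≡ q → y ≡ p ⊎ y ≡ q → z ≡ p ⊎ z ≡ q →
    x ≡ y ⊎ x ≡ z ⊎ y ≡ z
  pair-pigeonhole (inj₁ refl) (inj₁ refl) _ = inj₁ refl
  pair-pigeonhole (inj₂ refl) (inj₂ refl) _ = inj₁ refl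
  pair-pigeonhole (inj₁ refl) (inj₂ refl) (inj₁ refl) = inj₂ (inj₁ refl)
  pair-pigeonhole (inj₁ refl) (inj₂ refl) (inj₂ refl) = inj₂ (inj₂ refl)
  pair-pigeonhole (inj₂ refl) (inj₁ refl) (inj₁ refl) = inj₂ (inj₂ refl)
  pair-pigeonhole (inj₂ refl) (inj₁ refl) (inj₂ refl) = inj₂ (inj₁ refl)

  pair-other : ∀ {x y z} → x ≡ p ⊎ x ≡ q → y ≡ p ⊎ y ≡ q → z ≡ p ⊎ z ≡ q →
    x ≢ z → y ≢ z → x ≡ y
  pair-other x∈ y∈ z∈ x≢z y≢z with pair-pigeonhole x∈ y∈ z∈
  ... | inj₁ x≡y = x≡y
  ... | inj₂ (inj₁ x≡z) = ⊥-elim (x≢z x≡z)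
  ... | inj₂ (inj₂ y≡z) = ⊥-elim (y≢z y≡z)

split-of-4 : ∀ {m k} → m + k ≡ 4 → 0 < m → 0 < k →
  (m ≡ 1 → k ≤ 1) → (k ≡ 1 → m ≤ 1) → m ≡ 2 × k ≡ 2
split-of-4 {0} refl () _ _ _
split-of-4 {1} refl _ _ m≡1⇒k≤1 _ with m≡1⇒k≤1 refl
... | s≤s ()
split-of-4 {2} refl _ _ _ _ = refl , refl
split-of-4 {3} refl _ _ _ k≡1⇒m≤1 with k≡1⇒m≤1 refl
... | s≤s ()
split-of-4 {4} refl _ () _ _

sections-with-disjoint-images⇒injective : {A B : Set} {φ : B → A} {ψ₁ ψ₂ : A → B} →
  (∀ y → φ (ψ₁ y) ≡ y) → (∀ y → φ (ψ₂ y) ≡ y) → (∀ y → ψ₁ y ≢ ψ₂ y) →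
  Injective _≡_ _≡_ [ ψ₁ , ψ₂ ]
sections-with-disjoint-images⇒injective {φ = φ} s₁ _ _ {inj₁ y} {inj₁ y′} e =
  cong inj₁ (trans (sym (s₁ y)) (trans (cong φ e) (s₁ y′)))
sections-with-disjoint-images⇒injective {φ = φ} _ s₂ _ {inj₂ y} {inj₂ y′} e =
  cong inj₂ (trans (sym (s₂ y)) (trans (cong φ e) (s₂ y′)))
sections-with-disjoint-images⇒injective {φ = φ} s₁ s₂ disjoint {inj₁ y} {inj₂ y′} e
  with trans (sym (s₁ y)) (trans (cong φ e) (s₂ y′))
... | refl = ⊥-elim (disjoint y e)
sections-with-disjoint-images⇒injective {φ = φ} s₁ s₂ disjoint {inj₂ y} {inj₁ y′} e
  with trans (sym (s₂ y)) (trans (cong φ e) (s₁ y′))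
... | refl = ⊥-elim (disjoint y (sym e))

¬Fin⊎Fin↣Fin : ∀ {n} {f : Fin n ⊎ Fin n → Fin n} → Injective _≡_ _≡_ f → ¬ Fin n
¬Fin⊎Fin↣Fin {suc n} {f} f-inj _ =
  <⇒≱ (m<m+n (suc n) (s≤s z≤n)) (injective⇒≤ {f = f ∘ splitAt (suc n)} (splitAt-injective ∘ f-inj))
  where
  splitAt-injective : Injective _≡_ _≡_ (splitAt (suc n) {suc n})
  splitAt-injective {i} {j} e =
    trans (sym (join-splitAt (suc n) (suc n) i))
          (trans (cong (join (suc n) (suc n)) e) (join-splitAt (suc n) (suc n) j))

module Subgroup {n : ℕ} {Γ : Graph n} (G : AutSubgroup Γ) where
  open AutSubgroup G

  ∈⇒injective : ∀ {g} → g ∈ elems → Injective _≡_ _≡_ g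
  ∈⇒injective g∈ = proj₁ (all-aut _ g∈)

  ∈⇒adj-preserving : ∀ {g} → g ∈ elems → ∀ u v → Graph.adj Γ (g u) (g v) ≡ Graph.adj Γ u v
  ∈⇒adj-preserving g∈ = proj₂ (all-aut _ g∈)

  ε : Map n
  ε = proj₁ has-id

  ε∈ : ε ∈ elems
  ε∈ = proj₁ (proj₂ has-id)

  ε-fixes : ∀ x → ε x ≡ x
  ε-fixes = proj₂ (proj₂ has-id)

  left-quotient : ∀ {g h} → g ∈ elems → h ∈ elems →
    ∃[ c ] (c ∈ elems × ∀ x → g (c x) ≡ h x)
  left-quotient {g} {h} g∈ h∈ with closed-⁻¹ g g∈
  ... | k , k∈ , kg≡id with closed-∘ k h k∈ h∈
  ... | c , c∈ , c≡kh = c , c∈ , λ x → ∈⇒injective k∈ (trans (kg≡id (c x)) (c≡kh x))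

  right-quotient : ∀ {g h} → g ∈ elems → h ∈ elems →
    ∃[ m ] (m ∈ elems × ∀ x → m (g x) ≡ h x)
  right-quotient {g} {h} g∈ h∈ with closed-⁻¹ g g∈
  ... | k , k∈ , kg≡id with closed-∘ h k h∈ k∈
  ... | m , m∈ , m≡hk = m , m∈ , λ x → trans (m≡hk (g x)) (cong h (kg≡id x))

  conjugate : ∀ {h g} → h ∈ elems → g ∈ elems →
    ∃[ c ] (c ∈ elems × ∀ x → c (h x) ≡ h (g x))
  conjugate {h} {g} h∈ g∈ with closed-∘ h g h∈ g∈
  ... | hg , hg∈ , hg≡ with right-quotient h∈ hg∈
  ... | c , c∈ , ch≡hg = c , c∈ , λ x → trans (ch≡hg x) (hg≡ x)

  stabiliser : Fin n → List (Map n)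
  stabiliser v = filter (λ g → g v ≟ v) elems

  ∈-stabiliser⁺ : ∀ {v g} → g ∈ elems → g v ≡ v → g ∈ stabiliser v
  ∈-stabiliser⁺ {v} = ∈-filter⁺ (λ g → g v ≟ v)

  ∈-stabiliser⁻ : ∀ {v g} → g ∈ stabiliser v → g ∈ elems × g v ≡ v
  ∈-stabiliser⁻ {v} = ∈-filter⁻ (λ g → g v ≟ v) {xs = elems}

module HalfArcTransitiveOrientation {n : ℕ} (Γ : Graph n) (G : AutSubgroup Γ)
  (hat : HalfArcTransitive Γ G) (a b : Fin n) (ab : Adj Γ a b) where
  open Graph Γ
  open AutSubgroup G
  open Subgroup G
  open Orientation Γ G a b

  private
    vertex-transitive : VertexTransitive Γ G
    vertex-transitive = proj₁ hat

  SameOrbit-refl : ∀ {u v w} → SameOrbit (u , v , w) (u , v , w)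
  SameOrbit-refl {u} {v} {w} = ε , ε∈ , ε-fixes u , ε-fixes v , ε-fixes w

  SameOrbit-sym : ∀ {u v w u′ v′ w′} →
    SameOrbit (u , v , w) (u′ , v′ , w′) → SameOrbit (u′ , v′ , w′) (u , v , w)
  SameOrbit-sym {u} {v} {w} (g , g∈ , gu , gv , gw) with closed-⁻¹ g g∈
  ... | k , k∈ , kg≡id = k , k∈ , back gu , back gv , back gw
    where
    back : ∀ {x y} → g x ≡ y → k y ≡ x
    back {x} gx≡y = trans (cong k (sym gx≡y)) (kg≡id x)

  SameOrbit-trans : ∀ {u v w u′ v′ w′ u″ v″ w″} →
    SameOrbit (u , v , w) (u′ , v′ , w′) → SameOrbit (u′ , v′ , w′) (u″ , v″ , w″) →
    SameOrbit (u , v , w) (u″ , v″ , w″)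
  SameOrbit-trans {u} {v} {w} (g , g∈ , gu , gv , gw) (h , h∈ , hu , hv , hw)
    with closed-∘ h g h∈ g∈
  ... | c , c∈ , c≡hg = c , c∈ , then gu hu , then gv hv , then gw hw
    where
    then : ∀ {x y z} → g x ≡ y → h y ≡ z → c x ≡ z
    then {x} gx hy = trans (c≡hg x) (trans (cong h gx) hy)

  ⟶-invariant : ∀ {g u v} → g ∈ elems → u ⟶ v → g u ⟶ g v
  ⟶-invariant {g} g∈ (h , h∈ , ha , hb) with closed-∘ g h g∈ h∈
  ... | c , c∈ , c≡gh = c , c∈ , trans (c≡gh a) (cong g ha) , trans (c≡gh b) (cong g hb)

  ⟶-transitive : ∀ {u v x y} → u ⟶ v → x ⟶ y → ∃[ g ] (g ∈ elems × g u ≡ x × g v ≡ y)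
  ⟶-transitive (g₁ , g₁∈ , g₁a , g₁b) (g₂ , g₂∈ , g₂a , g₂b) with right-quotient g₁∈ g₂∈
  ... | m , m∈ , mg₁≡g₂ =
    m , m∈ , trans (cong m (sym g₁a)) (trans (mg₁≡g₂ a) g₂a) ,
             trans (cong m (sym g₁b)) (trans (mg₁≡g₂ b) g₂b)

  stabiliser-preserves-in : ∀ {g v x} → g ∈ elems → g v ≡ v → x ⟶ v → g x ⟶ v
  stabiliser-preserves-in {g} {x = x} g∈ gv x⟶v = subst (g x ⟶_) gv (⟶-invariant g∈ x⟶v)

  stabiliser-preserves-out : ∀ {g v z} → g ∈ elems → g v ≡ v → v ⟶ z → v ⟶ g z
  stabiliser-preserves-out {g} {z = z} g∈ gv v⟶z = subst (_⟶ g z) gv (⟶-invariant g∈ v⟶z)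

  ⟶⇒Adj : ∀ {u v} → u ⟶ v → Adj Γ u v
  ⟶⇒Adj (g , g∈ , refl , refl) = trans (∈⇒adj-preserving g∈ a b) ab

  Adj-sym : ∀ {u v} → Adj Γ u v → Adj Γ v u
  Adj-sym {u} {v} = trans (adj-sym v u)

  ⟶-irrefl : ∀ {u v} → u ⟶ v → u ≢ v
  ⟶-irrefl {u} u⟶v refl with trans (sym (⟶⇒Adj u⟶v)) (adj-irrefl u)
  ... | ()

  Adj⇒⟶⊎⟵ : ∀ {u v} → Adj Γ u v → u ⟶ v ⊎ v ⟶ u
  Adj⇒⟶⊎⟵ {u} {v} uv with proj₁ (proj₂ hat) a b u v ab uv
  ... | g , g∈ , inj₁ (ga , gb) = inj₁ (g , g∈ , ga , gb)
  ... | g , g∈ , inj₂ (ga , gb) = inj₂ (g , g∈ , ga , gb)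

  -- An edge carrying both arcs is mapped onto every other edge in both directions.
  ⟶-asym : ∀ {u v} → u ⟶ v → ¬ v ⟶ u
  ⟶-asym {u} {v} u⟶v v⟶u = proj₂ (proj₂ hat) λ x y x′ y′ xy x′y′ →
    ⟶-transitive (both-ways xy) (both-ways x′y′)
    where
    both-ways : ∀ {x y} → Adj Γ x y → x ⟶ y
    both-ways xy with Adj⇒⟶⊎⟵ xy
    ... | inj₁ x⟶y = x⟶y
    ... | inj₂ y⟶x with ⟶-transitive u⟶v y⟶x
    ... | m , m∈ , refl , refl = ⟶-invariant m∈ v⟶u

  _⟶?_ : ∀ u v → Dec (u ⟶ v)
  u ⟶? v with any? (λ g → (g a ≟ u) ×-dec (g b ≟ v)) elems
  ... | yes found = yes (find found)
  ... | no ¬found = no λ (g , g∈ , ga , gb) → ¬found (lose g∈ (ga , gb))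

  out-neighbour-exists : ∀ v → ∃[ w ] (v ⟶ w)
  out-neighbour-exists v with vertex-transitive a v
  ... | g , g∈ , refl = g b , ⟶-invariant g∈ (ε , ε∈ , ε-fixes a , ε-fixes b)

  in-neighbour-exists : ∀ v → ∃[ u ] (u ⟶ v)
  in-neighbour-exists v with vertex-transitive b v
  ... | g , g∈ , refl = g a , ⟶-invariant g∈ (ε , ε∈ , ε-fixes a , ε-fixes b)

  move-2-arc-to : ∀ v {x y z} → TwoArc x y z →
    ∃[ x′ ] ∃[ z′ ] (TwoArc x′ v z′ × SameOrbit (x , y , z) (x′ , v , z′))
  move-2-arc-to v {x} {y} {z} (x⟶y , y⟶z) with vertex-transitive y v
  ... | h , h∈ , refl =
    h x , h z , (⟶-invariant h∈ x⟶y , ⟶-invariant h∈ y⟶z) , (h , h∈ , refl , refl , refl)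

  Invariant : (Fin n → Fin n → Set) → Set
  Invariant R = ∀ {g x y} → g ∈ elems → R x y → R (g x) (g y)

  -- Otherwise y ↦ (the unique successor of y) would have the two sections
  -- y ↦ h_y u and y ↦ h_y u′ with disjoint images, where h_y maps v to y.
  unique-successor⇒unique-predecessor : (R : Fin n → Fin n → Set) → Invariant R →
    ∀ {v w u u′} → (∀ z → R v z → z ≡ w) → R u v → R u′ v → u ≡ u′
  unique-successor⇒unique-predecessor R R-invariant {v} {w} {u} {u′} only-w Ruv Ru′v
    with u ≟ u′
  ... | yes u≡u′ = u≡u′
  ... | no u≢u′ =
    ⊥-elim (¬Fin⊎Fin↣Fin (sections-with-disjoint-images⇒injective {φ = λ y → h y w}
      (section Ruv) (section Ru′v) (λ y → u≢u′ ∘ ∈⇒injective (h∈ y))) v)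
    where
    h : Fin n → Map n
    h y = proj₁ (vertex-transitive v y)
    h∈ : ∀ y → h y ∈ elems
    h∈ y = proj₁ (proj₂ (vertex-transitive v y))
    hv : ∀ y → h y v ≡ y
    hv y = proj₂ (proj₂ (vertex-transitive v y))

    successor-unique : ∀ y {z} → R y z → z ≡ h y w
    successor-unique y {z} Ryz with closed-⁻¹ (h y) (h∈ y)
    ... | k , k∈ , kh≡id = ∈⇒injective k∈ (trans (only-w (k z) Rv[kz]) (sym (kh≡id w)))
      where
      Rv[kz] : R v (k z)
      Rv[kz] = subst (λ t → R t (k z)) (trans (cong k (sym (hv y))) (kh≡id v)) (R-invariant k∈ Ryz)

    section : ∀ {x} → R x v → ∀ y → h (h y x) w ≡ y
    section {x} Rxv y =
      sym (successor-unique (h y x) (subst (R (h y x)) (hv y) (R-invariant (h∈ y) Rxv)))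

  distinct-2-arcs-share-no-edge : ∀ {x v z x′ z′} → x ⟶ v → v ⟶ z → x′ ⟶ v → v ⟶ z′ →
    x ≢ x′ → z ≢ z′ → NoCommonEdge x v z x′ z′
  distinct-2-arcs-share-no-edge {x} {v} {z} {x′} {z′} x⟶v v⟶z x′⟶v v⟶z′ x≢x′ z≢z′ =
    xv≠x′v , xv≠vz′ , vz≠x′v , vz≠vz′
    where
    xv≠x′v : ¬ SameEdge x v x′ v
    xv≠x′v (inj₁ (x≡x′ , _)) = x≢x′ x≡x′
    xv≠x′v (inj₂ (x≡v , _)) = ⟶-irrefl x⟶v x≡v
    xv≠vz′ : ¬ SameEdge x v v z′
    xv≠vz′ (inj₁ (x≡v , _)) = ⟶-irrefl x⟶v x≡v
    xv≠vz′ (inj₂ (refl , _)) = ⟶-asym x⟶v v⟶z′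
    vz≠x′v : ¬ SameEdge v z x′ v
    vz≠x′v (inj₁ (_ , z≡v)) = ⟶-irrefl v⟶z (sym z≡v)
    vz≠x′v (inj₂ (_ , refl)) = ⟶-asym x′⟶v v⟶z
    vz≠vz′ : ¬ SameEdge v z v z′
    vz≠vz′ (inj₁ (_ , z≡z′)) = z≢z′ z≡z′
    vz≠vz′ (inj₂ (v≡z′ , _)) = ⟶-irrefl v⟶z′ v≡z′

  FixInIffFixOut : Fin n → Set
  FixInIffFixOut y = ∀ {g} → g ∈ elems → g y ≡ y →
    ∀ {x z} → x ⟶ y → y ⟶ z → (g x ≡ x ⇔ g z ≡ z)

  FixInIffFixOut-everywhere : ∀ {v} → FixInIffFixOut v → ∀ y → FixInIffFixOut y
  FixInIffFixOut-everywhere {v} coupled y {g} g∈ gy {x} {z} x⟶y y⟶z with vertex-transitive y v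
  ... | h , h∈ , refl with conjugate h∈ g∈
  ... | c , c∈ , ch≡hg =
    mk⇔ (λ gx → back z (to coupled-at-v (forth x gx)))
        (λ gz → back x (from coupled-at-v (forth z gz)))
    where
    forth : ∀ t → g t ≡ t → c (h t) ≡ h t
    forth t gt = trans (ch≡hg t) (cong h gt)
    back : ∀ t → c (h t) ≡ h t → g t ≡ t
    back t cht = ∈⇒injective h∈ (trans (sym (ch≡hg t)) cht)
    coupled-at-v : c (h x) ≡ h x ⇔ c (h z) ≡ h z
    coupled-at-v = coupled c∈ (forth y gy) (⟶-invariant h∈ x⟶y) (⟶-invariant h∈ y⟶z)

  record Neighbourhood (v : Fin n) : Set where
    field
      u₁ u₂ w₁ w₂ : Fin n
      u₁⟶ : u₁ ⟶ v
      u₂⟶ : u₂ ⟶ v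
      ⟶w₁ : v ⟶ w₁
      ⟶w₂ : v ⟶ w₂
      u₁≢u₂ : u₁ ≢ u₂
      w₁≢w₂ : w₁ ≢ w₂
      in-pair : ∀ {x} → x ⟶ v → x ≡ u₁ ⊎ x ≡ u₂
      out-pair : ∀ {z} → v ⟶ z → z ≡ w₁ ⊎ z ≡ w₂

  module _ (tetravalent : Tetravalent Γ) where

    neighbours out-neighbours in-neighbours : Fin n → List (Fin n)
    neighbours v = filterᵇ (adj v) (allFin n)
    out-neighbours v = filter (v ⟶?_) (neighbours v)
    -- the complement of out-neighbours v, so that the degrees visibly add up
    in-neighbours v = filter (∁? (v ⟶?_)) (neighbours v)

    ∈-neighbours⁺ : ∀ {v x} → Adj Γ v x → x ∈ neighbours v
    ∈-neighbours⁺ {v} {x} vx = ∈-filter⁺ (T? ∘ adj v) (∈-allFin x) (from T-≡ vx)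

    ∈-neighbours⁻ : ∀ {v x} → x ∈ neighbours v → Adj Γ v x
    ∈-neighbours⁻ {v} x∈ = to T-≡ (proj₂ (∈-filter⁻ (T? ∘ adj v) {xs = allFin n} x∈))

    ∈-out-neighbours⁺ : ∀ {v z} → v ⟶ z → z ∈ out-neighbours v
    ∈-out-neighbours⁺ {v} v⟶z = ∈-filter⁺ (v ⟶?_) (∈-neighbours⁺ (⟶⇒Adj v⟶z)) v⟶z

    ∈-out-neighbours⁻ : ∀ {v z} → z ∈ out-neighbours v → v ⟶ z
    ∈-out-neighbours⁻ {v} z∈ = proj₂ (∈-filter⁻ (v ⟶?_) {xs = neighbours v} z∈)

    ∈-in-neighbours⁺ : ∀ {v x} → x ⟶ v → x ∈ in-neighbours v
    ∈-in-neighbours⁺ {v} x⟶v =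
      ∈-filter⁺ (∁? (v ⟶?_)) (∈-neighbours⁺ (Adj-sym (⟶⇒Adj x⟶v))) (λ v⟶x → ⟶-asym v⟶x x⟶v)

    ∈-in-neighbours⁻ : ∀ {v x} → x ∈ in-neighbours v → x ⟶ v
    ∈-in-neighbours⁻ {v} x∈ with ∈-filter⁻ (∁? (v ⟶?_)) {xs = neighbours v} x∈
    ... | x∈nbrs , ¬v⟶x with Adj⇒⟶⊎⟵ (∈-neighbours⁻ x∈nbrs)
    ... | inj₁ v⟶x = ⊥-elim (¬v⟶x v⟶x)
    ... | inj₂ x⟶v = x⟶v

    unique-neighbours : ∀ v → Unique (neighbours v)
    unique-neighbours v = filter⁺ (T? ∘ adj v) (allFin⁺ n)

    out-degree in-degree : Fin n → ℕ
    out-degree v = length (out-neighbours v)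
    in-degree v = length (in-neighbours v)

    out-degree≡1⇒in-degree≤1 : ∀ v → out-degree v ≡ 1 → in-degree v ≤ 1
    out-degree≡1⇒in-degree≤1 v deg≡1 with out-neighbour-exists v
    ... | w , v⟶w =
      length≤1 (filter⁺ (∁? (v ⟶?_)) (unique-neighbours v)) λ x∈ x′∈ →
        unique-successor⇒unique-predecessor _⟶_ ⟶-invariant
          (λ z v⟶z → length≡1⇒∈-equal deg≡1 (∈-out-neighbours⁺ v⟶z) (∈-out-neighbours⁺ v⟶w))
          (∈-in-neighbours⁻ x∈) (∈-in-neighbours⁻ x′∈)

    in-degree≡1⇒out-degree≤1 : ∀ v → in-degree v ≡ 1 → out-degree v ≤ 1
    in-degree≡1⇒out-degree≤1 v deg≡1 with in-neighbour-exists v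
    ... | u , u⟶v =
      length≤1 (filter⁺ (v ⟶?_) (unique-neighbours v)) λ z∈ z′∈ →
        unique-successor⇒unique-predecessor (λ x y → y ⟶ x) ⟶-invariant
          (λ x x⟶v → length≡1⇒∈-equal deg≡1 (∈-in-neighbours⁺ x⟶v) (∈-in-neighbours⁺ u⟶v))
          (∈-out-neighbours⁻ z∈) (∈-out-neighbours⁻ z′∈)

    out-degree≡2×in-degree≡2 : ∀ v → out-degree v ≡ 2 × in-degree v ≡ 2
    out-degree≡2×in-degree≡2 v =
      split-of-4 (trans (length-filter+length-filter∁ (v ⟶?_) (neighbours v)) (tetravalent v))
        (∈-length (∈-out-neighbours⁺ (proj₂ (out-neighbour-exists v))))
        (∈-length (∈-in-neighbours⁺ (proj₂ (in-neighbour-exists v))))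
        (out-degree≡1⇒in-degree≤1 v) (in-degree≡1⇒out-degree≤1 v)

    -- Opaque: nothing depends on which neighbours are chosen, and unfolding the
    -- choice makes unification normalise filters over allFin n.
    opaque
      neighbourhood : ∀ v → Neighbourhood v
      neighbourhood v
        with length≡2⇒pair (filter⁺ (∁? (v ⟶?_)) (unique-neighbours v))
                            (proj₂ (out-degree≡2×in-degree≡2 v))
           | length≡2⇒pair (filter⁺ (v ⟶?_) (unique-neighbours v))
                            (proj₁ (out-degree≡2×in-degree≡2 v))
      ... | u₁ , u₂ , u₁∈ , u₂∈ , u₁≢u₂ , in-pair | w₁ , w₂ , w₁∈ , w₂∈ , w₁≢w₂ , out-pair = record
        { u₁ = u₁ ; u₂ = u₂ ; w₁ = w₁ ; w₂ = w₂
        ; u₁⟶ = ∈-in-neighbours⁻ u₁∈ ; u₂⟶ = ∈-in-neighbours⁻ u₂∈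
        ; ⟶w₁ = ∈-out-neighbours⁻ w₁∈ ; ⟶w₂ = ∈-out-neighbours⁻ w₂∈
        ; u₁≢u₂ = u₁≢u₂ ; w₁≢w₂ = w₁≢w₂
        ; in-pair = in-pair ∘ ∈-in-neighbours⁺
        ; out-pair = out-pair ∘ ∈-out-neighbours⁺
        }

    module AtVertex (v : Fin n) where
      open Neighbourhood (neighbourhood v) public

      stabiliser-permutes-in : ∀ {g} → g ∈ elems → g v ≡ v →
        (g u₁ ≡ u₁ × g u₂ ≡ u₂) ⊎ (g u₁ ≡ u₂ × g u₂ ≡ u₁)
      stabiliser-permutes-in g∈ gv = fixes-or-swaps (∈⇒injective g∈) u₁≢u₂
        (in-pair (stabiliser-preserves-in g∈ gv u₁⟶)) (in-pair (stabiliser-preserves-in g∈ gv u₂⟶))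

      stabiliser-permutes-out : ∀ {g} → g ∈ elems → g v ≡ v →
        (g w₁ ≡ w₁ × g w₂ ≡ w₂) ⊎ (g w₁ ≡ w₂ × g w₂ ≡ w₁)
      stabiliser-permutes-out g∈ gv = fixes-or-swaps (∈⇒injective g∈) w₁≢w₂
        (out-pair (stabiliser-preserves-out g∈ gv ⟶w₁))
        (out-pair (stabiliser-preserves-out g∈ gv ⟶w₂))

      in-swapper : ∃[ r ] (r ∈ elems × r v ≡ v × r u₁ ≡ u₂)
      in-swapper with ⟶-transitive u₁⟶ u₂⟶
      ... | r , r∈ , ru₁ , rv = r , r∈ , rv , ru₁

      in-swapper-moves-in : ∀ {r x} → r ∈ elems → r v ≡ v → r u₁ ≡ u₂ → x ⟶ v → r x ≢ x
      in-swapper-moves-in r∈ rv ru₁ x⟶v with stabiliser-permutes-in r∈ rv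
      ... | inj₁ (ru₁≡u₁ , _) = ⊥-elim (u₁≢u₂ (trans (sym ru₁≡u₁) ru₁))
      ... | inj₂ (ru₁≡u₂ , ru₂≡u₁) = swaps-pair⇒moves u₁≢u₂ (in-pair x⟶v) ru₁≡u₂ ru₂≡u₁

      orbit-at-v : ∀ {x z} → x ⟶ v → v ⟶ z →
        SameOrbit (u₁ , v , w₁) (x , v , z) ⊎ SameOrbit (u₁ , v , w₂) (x , v , z)
      orbit-at-v x⟶v v⟶z with in-pair x⟶v | out-pair v⟶z
      ... | inj₁ refl | inj₁ refl = inj₁ SameOrbit-refl
      ... | inj₁ refl | inj₂ refl = inj₂ SameOrbit-refl
      ... | inj₂ refl | z∈ with in-swapper
      ... | r , r∈ , rv , ru₁ with permutes-pair⇒onto {f = r} (stabiliser-permutes-out r∈ rv) z∈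
      ...   | inj₁ rw₁ = inj₁ (r , r∈ , ru₁ , rv , rw₁)
      ...   | inj₂ rw₂ = inj₂ (r , r∈ , ru₁ , rv , rw₂)

      orbit-of-u₁vw₁-or-u₁vw₂ : ∀ {x y z} → TwoArc x y z →
        SameOrbit (u₁ , v , w₁) (x , y , z) ⊎ SameOrbit (u₁ , v , w₂) (x , y , z)
      orbit-of-u₁vw₁-or-u₁vw₂ xyz with move-2-arc-to v xyz
      ... | _ , _ , (x⟶v , v⟶z) , moved with orbit-at-v x⟶v v⟶z
      ... | inj₁ orbit = inj₁ (SameOrbit-trans orbit (SameOrbit-sym moved))
      ... | inj₂ orbit = inj₂ (SameOrbit-trans orbit (SameOrbit-sym moved))

      ArcStabiliserSwapsOut : Set
      ArcStabiliserSwapsOut = ∃[ q ] (q ∈ elems × q v ≡ v × q u₁ ≡ u₁ × q w₁ ≡ w₂)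

      ArcStabiliserSwapsOut? : Dec ArcStabiliserSwapsOut
      ArcStabiliserSwapsOut? with any? (λ g → (g v ≟ v) ×-dec (g u₁ ≟ u₁) ×-dec (g w₁ ≟ w₂)) elems
      ... | yes found = yes (find found)
      ... | no ¬found = no λ (g , g∈ , gv , gu₁ , gw₁) → ¬found (lose g∈ (gv , gu₁ , gw₁))

      transitive⇒ArcStabiliserSwapsOut : TransitiveOn2Arcs → ArcStabiliserSwapsOut
      transitive⇒ArcStabiliserSwapsOut transitive
        with transitive u₁ v w₁ u₁ v w₂ (u₁⟶ , ⟶w₁) (u₁⟶ , ⟶w₂)
      ... | q , q∈ , qu₁ , qv , qw₁ = q , q∈ , qv , qu₁ , qw₁

      ArcStabiliserSwapsOut⇒TransitiveOn2Arcs : ArcStabiliserSwapsOut → TransitiveOn2Arcs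
      ArcStabiliserSwapsOut⇒TransitiveOn2Arcs (q , q∈ , qv , qu₁ , qw₁) _ _ _ _ _ _ xyz x′y′z′ =
        SameOrbit-trans (SameOrbit-sym (from-u₁vw₁ xyz)) (from-u₁vw₁ x′y′z′)
        where
        from-u₁vw₁ : ∀ {x y z} → TwoArc x y z → SameOrbit (u₁ , v , w₁) (x , y , z)
        from-u₁vw₁ xyz with orbit-of-u₁vw₁-or-u₁vw₂ xyz
        ... | inj₁ orbit = orbit
        ... | inj₂ orbit = SameOrbit-trans (q , q∈ , qu₁ , qv , qw₁) orbit

      ArcStabiliserSwapsOut⇒2<stabSize : ArcStabiliserSwapsOut → 2 < stabSize Γ G v
      ArcStabiliserSwapsOut⇒2<stabSize (q , q∈ , qv , qu₁ , qw₁) with in-swapper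
      ... | r , r∈ , rv , ru₁ =
        2<length (∈-stabiliser⁺ ε∈ (ε-fixes v)) (∈-stabiliser⁺ q∈ qv) (∈-stabiliser⁺ r∈ rv)
          (λ ε≡q → w₁≢w₂ (trans (sym (ε-fixes w₁)) (trans (cong (λ f → f w₁) ε≡q) qw₁)))
          (λ ε≡r → u₁≢u₂ (trans (sym (ε-fixes u₁)) (trans (cong (λ f → f u₁) ε≡r) ru₁)))
          (λ q≡r → u₁≢u₂ (trans (sym qu₁) (trans (cong (λ f → f u₁) q≡r) ru₁)))

      swaps-in-fixes-out⇒ArcStabiliserSwapsOut : ∀ {g} → g ∈ elems → g v ≡ v →
        g u₁ ≡ u₂ → g w₂ ≡ w₂ → ArcStabiliserSwapsOut
      swaps-in-fixes-out⇒ArcStabiliserSwapsOut {g} g∈ gv gu₁ gw₂ with ⟶-transitive ⟶w₁ ⟶w₂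
      ... | s , s∈ , sv , sw₁ with stabiliser-permutes-in s∈ sv
      ... | inj₁ (su₁ , _) = s , s∈ , sv , su₁ , sw₁
      ... | inj₂ (su₁ , _) with left-quotient g∈ s∈
      ... | c , c∈ , gc≡s =
        c , c∈ , cancel (trans sv (sym gv)) , cancel (trans su₁ (sym gu₁)) ,
        cancel (trans sw₁ (sym gw₂))
        where
        cancel : ∀ {x y} → s x ≡ g y → c x ≡ y
        cancel {x} sx≡gy = ∈⇒injective g∈ (trans (gc≡s x) sx≡gy)

      ¬ArcStabiliserSwapsOut⇒FixInIffFixOut : ¬ ArcStabiliserSwapsOut → FixInIffFixOut v
      ¬ArcStabiliserSwapsOut⇒FixInIffFixOut ¬swap {g} g∈ gv x⟶v v⟶z
        with stabiliser-permutes-in g∈ gv | stabiliser-permutes-out g∈ gv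
      ... | inj₁ (gu₁ , gu₂) | inj₁ (gw₁ , gw₂) =
        mk⇔ (λ _ → fixes-pair⇒fixes (out-pair v⟶z) gw₁ gw₂)
            (λ _ → fixes-pair⇒fixes (in-pair x⟶v) gu₁ gu₂)
      ... | inj₂ (gu₁ , gu₂) | inj₂ (gw₁ , gw₂) =
        mk⇔ (⊥-elim ∘ swaps-pair⇒moves u₁≢u₂ (in-pair x⟶v) gu₁ gu₂)
            (⊥-elim ∘ swaps-pair⇒moves w₁≢w₂ (out-pair v⟶z) gw₁ gw₂)
      ... | inj₁ (gu₁ , _) | inj₂ (gw₁ , _) = ⊥-elim (¬swap (g , g∈ , gv , gu₁ , gw₁))
      ... | inj₂ (gu₁ , _) | inj₁ (_ , gw₂) =
        ⊥-elim (¬swap (swaps-in-fixes-out⇒ArcStabiliserSwapsOut g∈ gv gu₁ gw₂))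

    transitive⇒2<stabSize : TransitiveOn2Arcs → ∀ v → 2 < stabSize Γ G v
    transitive⇒2<stabSize transitive v =
      ArcStabiliserSwapsOut⇒2<stabSize (transitive⇒ArcStabiliserSwapsOut transitive)
      where open AtVertex v

    module Rigid (connected : Connected Γ) (coupled : ∀ y → FixInIffFixOut y) where

      fixes-neighbour⇒fixes-neighbours : ∀ {g y x₀ x} → g ∈ elems → g y ≡ y →
        Adj Γ y x₀ → g x₀ ≡ x₀ → Adj Γ y x → g x ≡ x
      fixes-neighbour⇒fixes-neighbours {g} {y} {x₀} {x} g∈ gy yx₀ gx₀ yx = fixes (Adj⇒⟶⊎⟵ yx)
        where
        open AtVertex y
        at-y : ∀ {x z} → x ⟶ y → y ⟶ z → g x ≡ x ⇔ g z ≡ z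
        at-y = coupled y g∈ gy
        gw₁ : g w₁ ≡ w₁
        gw₁ with Adj⇒⟶⊎⟵ yx₀
        ... | inj₁ y⟶x₀ = to (at-y u₁⟶ ⟶w₁) (from (at-y u₁⟶ y⟶x₀) gx₀)
        ... | inj₂ x₀⟶y = to (at-y x₀⟶y ⟶w₁) gx₀
        fixes : y ⟶ x ⊎ x ⟶ y → g x ≡ x
        fixes (inj₁ y⟶x) = to (at-y u₁⟶ y⟶x) (from (at-y u₁⟶ ⟶w₁) gw₁)
        fixes (inj₂ x⟶y) = from (at-y x⟶y ⟶w₁) gw₁

      fixes-edge⇒fixes-all : ∀ {g v x} → g ∈ elems → Adj Γ v x → g v ≡ v → g x ≡ x →
        ∀ y → g y ≡ y
      fixes-edge⇒fixes-all {g} {v} g∈ vx gv gx y = walk gv vx gx (connected v y)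
        where
        walk : ∀ {y z x₀} → g y ≡ y → Adj Γ y x₀ → g x₀ ≡ x₀ → Reach Γ y z → g z ≡ z
        walk gy _ _ here = gy
        walk gy yx₀ gx₀ (step yy′ path) =
          walk (fixes-neighbour⇒fixes-neighbours g∈ gy yx₀ gx₀ yy′) (Adj-sym yy′) gy path

      agree-on-edge⇒≐ : ∀ {g h v x} → g ∈ elems → h ∈ elems → Adj Γ v x →
        g v ≡ h v → g x ≡ h x → g ≐ h
      agree-on-edge⇒≐ {g} {h} {v} {x} g∈ h∈ vx gv≡hv gx≡hx t with left-quotient h∈ g∈
      ... | c , c∈ , hc≡g =
        trans (sym (hc≡g t)) (cong h (fixes-edge⇒fixes-all c∈ vx (fixed gv≡hv) (fixed gx≡hx) t))
        where
        fixed : ∀ {y} → g y ≡ h y → c y ≡ y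
        fixed {y} gy≡hy = ∈⇒injective h∈ (trans (hc≡g y) gy≡hy)

      stabSize≤2 : ∀ v → stabSize Γ G v ≤ 2
      stabSize≤2 v = AllPairs⇒length≤2 (AllPairs.filter⁺ (λ g → g v ≟ v) distinct) no-three
        where
        open AtVertex v
        image-of-u₁ : ∀ {g} → g ∈ stabiliser v → g u₁ ≡ u₁ ⊎ g u₁ ≡ u₂
        image-of-u₁ g∈ with ∈-stabiliser⁻ g∈
        ... | g∈G , gv = in-pair (stabiliser-preserves-in g∈G gv u₁⟶)
        agree-on-u₁ : ∀ {g h} → g ∈ stabiliser v → h ∈ stabiliser v → g u₁ ≡ h u₁ → g ≐ h
        agree-on-u₁ g∈ h∈ with ∈-stabiliser⁻ g∈ | ∈-stabiliser⁻ h∈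
        ... | g∈G , gv | h∈G , hv =
          agree-on-edge⇒≐ g∈G h∈G (Adj-sym (⟶⇒Adj u₁⟶)) (trans gv (sym hv))
        no-three : ∀ {f g h} → f ∈ stabiliser v → g ∈ stabiliser v → h ∈ stabiliser v →
          ¬ (f ≐ g) → ¬ (f ≐ h) → ¬ (g ≐ h) → ⊥
        no-three f∈ g∈ h∈ f≉g f≉h g≉h
          with pair-pigeonhole (image-of-u₁ f∈) (image-of-u₁ g∈) (image-of-u₁ h∈)
        ... | inj₁ fu₁≡gu₁ = f≉g (agree-on-u₁ f∈ g∈ fu₁≡gu₁)
        ... | inj₂ (inj₁ fu₁≡hu₁) = f≉h (agree-on-u₁ f∈ h∈ fu₁≡hu₁)
        ... | inj₂ (inj₂ gu₁≡hu₁) = g≉h (agree-on-u₁ g∈ h∈ gu₁≡hu₁)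

      exactly-two-orbits : ExactlyTwoOrbits
      exactly-two-orbits =
        u₁ , a , w₁ , u₁ , a , w₂ , (u₁⟶ , ⟶w₁) , (u₁⟶ , ⟶w₂) , different ,
        λ _ _ _ → orbit-of-u₁vw₁-or-u₁vw₂
        where
        open AtVertex a
        different : ¬ SameOrbit (u₁ , a , w₁) (u₁ , a , w₂)
        different (g , g∈ , gu₁ , ga , gw₁) =
          w₁≢w₂ (trans (sym (to (coupled a g∈ ga u₁⟶ ⟶w₁) gu₁)) gw₁)

      two-per-orbit : TwoPerOrbitAtEachVertex
      two-per-orbit x y z xyz v with move-2-arc-to v xyz | AtVertex.in-swapper v
      ... | x₀ , z₀ , (x₀⟶ , ⟶z₀) , moved | r , r∈ , rv , ru₁ =
        x₀ , z₀ , r x₀ , r z₀ , (x₀⟶ , ⟶z₀) , moved ,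
        (rx₀⟶ , ⟶rz₀) , SameOrbit-trans moved (r , r∈ , refl , rv , refl) ,
        (λ (x₀≡rx₀ , _) → rx₀≢x₀ (sym x₀≡rx₀)) ,
        (λ _ _ (s⟶ , _) orbit → two-candidates s⟶ (SameOrbit-trans (SameOrbit-sym moved) orbit)) ,
        distinct-2-arcs-share-no-edge x₀⟶ ⟶z₀ rx₀⟶ ⟶rz₀ (rx₀≢x₀ ∘ sym) (rz₀≢z₀ ∘ sym)
        where
        open AtVertex v using (in-pair; in-swapper-moves-in)
        rx₀⟶ : r x₀ ⟶ v
        rx₀⟶ = stabiliser-preserves-in r∈ rv x₀⟶
        ⟶rz₀ : v ⟶ r z₀
        ⟶rz₀ = stabiliser-preserves-out r∈ rv ⟶z₀
        rx₀≢x₀ : r x₀ ≢ x₀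
        rx₀≢x₀ = in-swapper-moves-in r∈ rv ru₁ x₀⟶
        rz₀≢z₀ : r z₀ ≢ z₀
        rz₀≢z₀ = rx₀≢x₀ ∘ from (coupled v r∈ rv x₀⟶ ⟶z₀)
        agree-on-vx₀ : ∀ {g h} → g ∈ elems → h ∈ elems → g v ≡ h v → g x₀ ≡ h x₀ → g z₀ ≡ h z₀
        agree-on-vx₀ g∈ h∈ gv≡hv gx₀≡hx₀ =
          agree-on-edge⇒≐ g∈ h∈ (Adj-sym (⟶⇒Adj x₀⟶)) gv≡hv gx₀≡hx₀ z₀
        two-candidates : ∀ {s t} → s ⟶ v → SameOrbit (x₀ , v , z₀) (s , v , t) →
          (s ≡ x₀ × t ≡ z₀) ⊎ (s ≡ r x₀ × t ≡ r z₀)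
        two-candidates {s} s⟶ (e , e∈ , ex₀ , ev , ez₀) with s ≟ x₀
        ... | yes refl = inj₁ (refl , trans (sym ez₀)
          (trans (agree-on-vx₀ e∈ ε∈ (trans ev (sym (ε-fixes v))) (trans ex₀ (sym (ε-fixes s))))
                 (ε-fixes z₀)))
        ... | no s≢x₀ =
          inj₂ (s≡rx₀ , trans (sym ez₀) (agree-on-vx₀ e∈ r∈ (trans ev (sym rv)) (trans ex₀ s≡rx₀)))
          where
          s≡rx₀ : s ≡ r x₀
          s≡rx₀ = pair-other (in-pair s⟶) (in-pair rx₀⟶) (in-pair x₀⟶) s≢x₀ rx₀≢x₀

    module _ (connected : Connected Γ) where

      ¬ArcStabiliserSwapsOut⇒coupled : ¬ AtVertex.ArcStabiliserSwapsOut a → ∀ y → FixInIffFixOut y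
      ¬ArcStabiliserSwapsOut⇒coupled =
        FixInIffFixOut-everywhere ∘ AtVertex.¬ArcStabiliserSwapsOut⇒FixInIffFixOut a

      2<stabSize⇒transitive : (∀ v → 2 < stabSize Γ G v) → TransitiveOn2Arcs
      2<stabSize⇒transitive large with AtVertex.ArcStabiliserSwapsOut? a
      ... | yes swap = AtVertex.ArcStabiliserSwapsOut⇒TransitiveOn2Arcs a swap
      ... | no ¬swap =
        ⊥-elim (<⇒≱ (large a) (Rigid.stabSize≤2 connected (¬ArcStabiliserSwapsOut⇒coupled ¬swap) a))

      stabSize≡2⇒two-orbits : (∀ v → stabSize Γ G v ≡ 2) →
        ExactlyTwoOrbits × TwoPerOrbitAtEachVertex
      stabSize≡2⇒two-orbits stabSize≡2 = exactly-two-orbits , two-per-orbit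
        where
        ¬swap : ¬ AtVertex.ArcStabiliserSwapsOut a
        ¬swap = <-irrefl (sym (stabSize≡2 a)) ∘ AtVertex.ArcStabiliserSwapsOut⇒2<stabSize a
        open Rigid connected (¬ArcStabiliserSwapsOut⇒coupled ¬swap)

lemma3p3 : ∀ {n} (Γ : Graph n) → Connected Γ → Tetravalent Γ → Girth5 Γ →
    (G : AutSubgroup Γ) → HalfArcTransitive Γ G →
    (a b : Fin n) → Adj Γ a b →
    (Orientation.TransitiveOn2Arcs Γ G a b ⇔ (∀ v → 2 < stabSize Γ G v)) ×
    ((∀ v → stabSize Γ G v ≡ 2) →
      Orientation.ExactlyTwoOrbits Γ G a b ×
      Orientation.TwoPerOrbitAtEachVertex Γ G a b)
lemma3p3 Γ connected tetravalent _ G hat a b ab =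
  mk⇔ (transitive⇒2<stabSize tetravalent) (2<stabSize⇒transitive tetravalent connected) ,
  stabSize≡2⇒two-orbits tetravalent connected
  where open HalfArcTransitiveOrientation Γ G hat a b ab
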